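{- For $n,k\ge1$, the number $f^{\mathrm{rlm}}(n,k)$ of flattened permutations of length $n$ with exactly $k$ right-to-left minima equals the Stirling number of the second kind $\left\{ {n-1 \atop k-1}\right\}$.
   Context: A permutation of $[n]$ is written $\pi=\pi_1\cdots\pi_n$. A run is a maximal block of consecutive increasing entries. A permutation is flattened if the first entries of its runs, read from left to right, are increasing. A right-to-left minimum of $\pi$ is an entry $\pi_i$ such that $\pi_i<\pi_j$ for all $j>i$. -}

module Defs where

open import Data.Nat using (ℕ; zero; suc; _+_; _*_; _<_; _<?_)
open import Data.Fin using (Fin; toℕ)
open import Data.Vec using (Vec; []; _∷_; toList)
open import Data.List using (List; []; _∷_; map; concatMap; length; filter; allFin)
open import Data.List.Relation.Unary.All using (All; all?)
open import Data.List.Relation.Unary.Unique.Propositional using (Unique)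
open import Data.List.Relation.Unary.Unique.DecPropositional using (unique?)
open import Data.List.Relation.Unary.Linked using (Linked)
import Data.List.Relation.Unary.Linked as Lk
open import Data.Product using (_×_)
open import Relation.Nullary using (Dec; yes; no)
open import Relation.Nullary.Decidable using (_×-dec_)
import Data.Fin.Properties as FinP

S2 : ℕ → ℕ → ℕ
S2 zero    zero    = 1
S2 zero    (suc k) = 0
S2 (suc n) zero    = 0
S2 (suc n) (suc k) = suc k * S2 n (suc k) + S2 n k

-- All words of length m over the alphabet [n] = Fin n (values 0..n-1 encode 1..n).
words : (m n : ℕ) → List (Vec (Fin n) m)
words zero    n = [] ∷ []
words (suc m) n = concatMap (λ x → map (x ∷_) (words m n)) (allFin n)

IsPerm : ∀ {n} → Vec (Fin n) n → Set
IsPerm v = Unique (toList v)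

isPerm? : ∀ {n} (v : Vec (Fin n) n) → Dec (IsPerm v)
isPerm? v = unique? FinP._≟_ (toList v)

-- First entries of the runs (maximal increasing blocks) of a word, left to right.
-- runStartsFrom p w : the run starts of w, where p is the entry preceding w.
runStartsFrom : ℕ → List ℕ → List ℕ
runStartsFrom p []       = []
runStartsFrom p (x ∷ xs) with p <? x
... | yes _ = runStartsFrom x xs
... | no  _ = x ∷ runStartsFrom x xs

runStarts : List ℕ → List ℕ
runStarts []       = []
runStarts (x ∷ xs) = x ∷ runStartsFrom x xs

Flattened : List ℕ → Set
Flattened w = Linked _<_ (runStarts w)

flattened? : (w : List ℕ) → Dec (Flattened w)
flattened? w = Lk.linked? _<?_ (runStarts w)

rlm : List ℕ → ℕ
rlm []       = 0
rlm (x ∷ xs) with all? (x <?_) xs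
... | yes _ = suc (rlm xs)
... | no  _ = rlm xs

oneLine : ∀ {n} → Vec (Fin n) n → List ℕ
oneLine v = map toℕ (toList v)

frlm : ℕ → ℕ → ℕ
frlm n k = length (filter
  (λ v → isPerm? v ×-dec (flattened? (oneLine v) ×-dec (rlm (oneLine v) Data.Nat.≟ k)))
  (words n n))

-- Permutations of [n] are handled as lists of the values 0, …, n-1. A word is flattened iff it
-- starts with its minimum and every entry beginning a new run is a right-to-left minimum.
-- Hence deleting the maximum n from a flattened permutation of [n+1] leaves a flattened
-- permutation of [n]; conversely, inserting n into a flattened permutation with r right-to-left
-- minima gives a flattened permutation exactly when n goes at the end (r + 1 right-to-left
-- minima) or just before one of the r - 1 right-to-left minima other than the first entry
-- (r of them). So f(n+1,k+1) = k f(n,k+1) + f(n,k), the recurrence of S(n,k).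
-- Counting over all words of length n agrees with counting over the list of flattened
-- permutations built this way, as both lists are duplicate-free with the same members.

module Submission where

open import Defs
open import Data.Nat using (ℕ; zero; suc; pred; _+_; _*_; _<_; _≤_; _≰_; _≥_; _∸_; _<?_; _≟_)
open import Data.Nat.Properties
  using (<-irrefl; <-asym; <-trans; ≤-refl; ≤-<-trans; <⇒≤; >⇒≢; ≤∧≢⇒<; m<n⇒m<1+n; m<1+n⇒m≤n;
         n<1+n; 1+n≰n; 1+n≢n; suc-injective; *-zeroʳ; *-identityʳ; module ≤-Reasoning)
open import Data.Nat.Tactic.RingSolver using (solve-∀)
open import Data.Fin using (Fin; toℕ; fromℕ<)
open import Data.Fin.Properties using (toℕ-injective; toℕ<n; toℕ-fromℕ<)
open import Data.Vec as Vec using (Vec; []; _∷_; toList)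
import Data.Vec.Properties as VecP
open import Data.List using (List; []; _∷_; [_]; _++_; concat; concatMap; map; length; filter; replicate; upTo)
open import Data.List.Properties
  using (∷-injectiveˡ; ∷-injectiveʳ; length-++; length-map; length-replicate; length-upTo; length-filter;
         map-++; map-replicate; map-cong-local; map-concatMap; concatMap-map;
         filter-++; filter-all; filter-none; filter-accept; filter-reject)
open import Data.List.Relation.Unary.All as All using (All; []; _∷_; all?)
import Data.List.Relation.Unary.All.Properties as AllP
open import Data.List.Relation.Unary.Any using (here; there)
open import Data.List.Relation.Unary.Linked as Linked using (Linked; []; [-]; _∷_)
open import Data.List.Relation.Unary.Unique.Propositional using (Unique; []; _∷_)
import Data.List.Relation.Unary.Unique.Propositional.Properties as UniqueP
open import Data.List.Relation.Binary.Disjoint.Propositional using (Disjoint)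
open import Data.List.Relation.Binary.Permutation.Propositional using (_↭_; ↭-sym; ↭⇒↭ₛ)
open import Data.List.Relation.Binary.Permutation.Propositional.Properties using (shift; ↭-length; All-resp-↭)
import Data.List.Relation.Binary.Permutation.Setoid.Properties as PermutationₛP
open import Data.List.Relation.Binary.BagAndSetEquality using (_∼[_]_; set; ∼bag⇒↭)
open import Data.List.Membership.Propositional using (_∈_; _∉_; find; lose)
open import Data.List.Membership.Propositional.Properties
  using (∈-∃++; ∈-map⁺; ∈-map⁻; ∈-filter⁺; ∈-filter⁻; ∈-concatMap⁺; ∈-concatMap⁻; ∈-upTo⁺; ∈-allFin)
open import Data.List.Membership.Propositional.Properties.WithK using (unique∧set⇒bag)
open import Data.List.Membership.DecPropositional _≟_ using (_∈?_)
open import Data.Product using (_×_; _,_; proj₁; proj₂; ∃; ∃₂; ∃-syntax; curry)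
open import Data.Sum using (_⊎_; inj₁; inj₂; map₂)
open import Data.Unit using (⊤; tt)
open import Function using (id; _∘_; _⇔_; mk⇔; Equivalence)
open import Level using (0ℓ)
open import Relation.Binary.PropositionalEquality
  using (_≡_; _≢_; refl; sym; trans; cong; cong₂; subst; ≢-sym; setoid; module ≡-Reasoning)
open import Relation.Nullary using (Dec; yes; no; ¬_; contradiction)
open import Relation.Nullary.Decidable using (_×-dec_; _⊎-dec_)
open import Relation.Unary using (Pred; Decidable)

module _ {A : Set} where

  length-unique-set : {xs ys : List A} → Unique xs → Unique ys → xs ∼[ set ] ys → length xs ≡ length ys
  length-unique-set xs-uniq ys-uniq xs∼ys = ↭-length (∼bag⇒↭ (unique∧set⇒bag xs-uniq ys-uniq xs∼ys))

  module _ {B : Set} {P : Pred B 0ℓ} {Q : Pred A 0ℓ} (P? : Decidable P) (Q? : Decidable Q) where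

    filter-map : ∀ (f : A → B) {xs} → All (λ x → P (f x) ⇔ Q x) xs →
                 filter P? (map f xs) ≡ map f (filter Q? xs)
    filter-map f {[]}     []                 = refl
    filter-map f {x ∷ xs} (Pfx⇔Qx ∷ Pf⇔Q) with P? (f x) | Q? x
    ... | yes _   | yes _  = cong (f x ∷_) (filter-map f Pf⇔Q)
    ... | no  _   | no  _  = filter-map f Pf⇔Q
    ... | yes Pfx | no ¬Qx = contradiction (Equivalence.to Pfx⇔Qx Pfx) ¬Qx
    ... | no ¬Pfx | yes Qx = contradiction (Equivalence.from Pfx⇔Qx Qx) ¬Pfx

  unique-concatMap : ∀ {B : Set} (f : A → List B) (g : B → A) {xs} → Unique xs →
                     (∀ {x} → x ∈ xs → Unique (f x)) →
                     (∀ {x y} → x ∈ xs → y ∈ f x → g y ≡ x) →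
                     Unique (concatMap f xs)
  unique-concatMap f g {[]}     []           _     _    = []
  unique-concatMap f g {x ∷ xs} (x∉xs ∷ xs-uniq) f-uniq g∘f≡id =
    UniqueP.++⁺ (f-uniq (here refl)) (unique-concatMap f g xs-uniq (f-uniq ∘ there) (g∘f≡id ∘ there)) disjoint
    where
    disjoint : Disjoint (f x) (concatMap f xs)
    disjoint (y∈fx , y∈fxs) with x′ , x′∈xs , y∈fx′ ← find (∈-concatMap⁻ f {xs = xs} y∈fxs) =
      All.lookup x∉xs x′∈xs (trans (sym (g∘f≡id (here refl) y∈fx)) (g∘f≡id (there x′∈xs) y∈fx′))

Unique-resp-↭ : ∀ {A : Set} {xs ys : List A} → xs ↭ ys → Unique xs → Unique ys
Unique-resp-↭ {A} xs↭ys = PermutationₛP.Unique-resp-↭ (setoid A) (↭⇒↭ₛ xs↭ys)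

length-unique-bounded : ∀ {n w} → Unique w → All (_< n) w → length w ≤ n
length-unique-bounded {n} {w} w-uniq w<n = begin
  length w                          ≡⟨ length-unique-set w-uniq (UniqueP.filter⁺ (_∈? w) (UniqueP.upTo⁺ n)) same ⟩
  length (filter (_∈? w) (upTo n))  ≤⟨ length-filter (_∈? w) (upTo n) ⟩
  length (upTo n)                   ≡⟨ length-upTo n ⟩
  n                                 ∎
  where
  open ≤-Reasoning
  same : w ∼[ set ] filter (_∈? w) (upTo n)
  same = mk⇔ (λ z∈w → ∈-filter⁺ (_∈? w) (∈-upTo⁺ (All.lookup w<n z∈w)) z∈w)
             (proj₂ ∘ ∈-filter⁻ (_∈? w) {xs = upTo n})

insertions : ∀ {A : Set} → A → List A → List (List A)
insertions x []       = [ x ] ∷ []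
insertions x (y ∷ ys) = (x ∷ y ∷ ys) ∷ map (y ∷_) (insertions x ys)

module _ {A : Set} {x : A} where

  ∈-insertions⁺ : ∀ (as bs : List A) → as ++ x ∷ bs ∈ insertions x (as ++ bs)
  ∈-insertions⁺ []       []       = here refl
  ∈-insertions⁺ []       (b ∷ bs) = here refl
  ∈-insertions⁺ (a ∷ as) bs       = there (∈-map⁺ (a ∷_) (∈-insertions⁺ as bs))

  ∈-insertions⁻ : ∀ ys {w} → w ∈ insertions x ys → ∃₂ λ as bs → ys ≡ as ++ bs × w ≡ as ++ x ∷ bs
  ∈-insertions⁻ []       (here refl) = [] , [] , refl , refl
  ∈-insertions⁻ (y ∷ ys) (here refl) = [] , y ∷ ys , refl , refl
  ∈-insertions⁻ (y ∷ ys) (there w∈)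
    with z , z∈ , refl ← ∈-map⁻ (y ∷_) w∈
    with as , bs , refl , refl ← ∈-insertions⁻ ys z∈ = y ∷ as , bs , refl , refl

  insertion-↭ : ∀ {ys w} → w ∈ insertions x ys → w ↭ x ∷ ys
  insertion-↭ {ys} w∈ with as , bs , refl , refl ← ∈-insertions⁻ ys w∈ = shift x as bs

  insertions-unique : ∀ {ys} → x ∉ ys → Unique (insertions x ys)
  insertions-unique {[]}     _    = [] ∷ []
  insertions-unique {y ∷ ys} x∉ys =
    All.tabulate front≢ ∷ UniqueP.map⁺ ∷-injectiveʳ (insertions-unique (x∉ys ∘ there))
    where
    front≢ : ∀ {w} → w ∈ map (y ∷_) (insertions x ys) → x ∷ y ∷ ys ≢ w
    front≢ w∈ eq with _ , _ , refl ← ∈-map⁻ (y ∷_) w∈ = x∉ys (here (∷-injectiveˡ eq))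

All-insertion⁺ : ∀ {A : Set} {P : Pred A 0ℓ} {x ys w} → w ∈ insertions x ys → P x → All P ys → All P w
All-insertion⁺ w∈ Px Pys = All-resp-↭ (↭-sym (insertion-↭ w∈)) (Px ∷ Pys)

All-insertion⁻ : ∀ {A : Set} {P : Pred A 0ℓ} {x ys w} → w ∈ insertions x ys → All P w → All P ys
All-insertion⁻ w∈ = All.tail ∘ All-resp-↭ (insertion-↭ w∈)

filter-<-insertion : ∀ {n ys w} → All (_< n) ys → w ∈ insertions n ys → filter (_<? n) w ≡ ys
filter-<-insertion {n} {ys} ys<n w∈ with as , bs , refl , refl ← ∈-insertions⁻ ys w∈ = begin
  filter (_<? n) (as ++ n ∷ bs)                  ≡⟨ filter-++ (_<? n) as (n ∷ bs) ⟩
  filter (_<? n) as ++ filter (_<? n) (n ∷ bs)  ≡⟨ cong (filter (_<? n) as ++_) (filter-reject (_<? n) (<-irrefl refl)) ⟩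
  filter (_<? n) as ++ filter (_<? n) bs        ≡⟨ cong₂ _++_ (filter-all (_<? n) as<n) (filter-all (_<? n) bs<n) ⟩
  as ++ bs                                      ∎
  where
  open ≡-Reasoning
  as<n = proj₁ (AllP.++⁻ as ys<n)
  bs<n = proj₂ (AllP.++⁻ as ys<n)

-- Flattened words

rlm-∷-min : ∀ {y ys} → All (y <_) ys → rlm (y ∷ ys) ≡ suc (rlm ys)
rlm-∷-min {y} {ys} y<ys with all? (y <?_) ys
... | yes _     = refl
... | no ¬y<ys = contradiction y<ys ¬y<ys

rlm-∷-nonmin : ∀ {y ys} → ¬ All (y <_) ys → rlm (y ∷ ys) ≡ rlm ys
rlm-∷-nonmin {y} {ys} ¬y<ys with all? (y <?_) ys
... | yes y<ys = contradiction y<ys ¬y<ys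
... | no _      = refl

FlatFrom : ℕ → List ℕ → Set
FlatFrom p []       = ⊤
FlatFrom p (y ∷ ys) = (p < y ⊎ All (y <_) ys) × FlatFrom y ys

Flat : List ℕ → Set
Flat []       = ⊤
Flat (x ∷ xs) = All (x <_) xs × FlatFrom x xs

flatFrom? : ∀ p ys → Dec (FlatFrom p ys)
flatFrom? p []       = yes tt
flatFrom? p (y ∷ ys) = ((p <? y) ⊎-dec all? (y <?_) ys) ×-dec flatFrom? y ys

flat? : ∀ w → Dec (Flat w)
flat? []       = yes tt
flat? (x ∷ xs) = all? (x <?_) xs ×-dec flatFrom? x xs

All-runStartsFrom : ∀ {P : Pred ℕ 0ℓ} p xs → All P xs → All P (runStartsFrom p xs)
All-runStartsFrom p []       []          = []
All-runStartsFrom p (y ∷ ys) (Py ∷ Pys) with p <? y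
... | yes _ = All-runStartsFrom y ys Pys
... | no  _ = Py ∷ All-runStartsFrom y ys Pys

Linked-∷ : ∀ {x rs} → All (x <_) rs → Linked _<_ rs → Linked _<_ (x ∷ rs)
Linked-∷ []          _  = [-]
Linked-∷ (x<r ∷ _) rs↗ = x<r ∷ rs↗

flatFrom⇒linked : ∀ p xs → FlatFrom p xs → Linked _<_ (runStartsFrom p xs)
flatFrom⇒linked p []       _                 = []
flatFrom⇒linked p (y ∷ ys) (p<y⊎y<ys , flat) with p <? y | p<y⊎y<ys
... | yes _   | _          = flatFrom⇒linked y ys flat
... | no p≮y | inj₁ p<y   = contradiction p<y p≮y
... | no _    | inj₂ y<ys = Linked-∷ (All-runStartsFrom y ys y<ys) (flatFrom⇒linked y ys flat)

flat⇒flattened : ∀ w → Flat w → Flattened w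
flat⇒flattened []       _              = []
flat⇒flattened (x ∷ xs) (x<xs , flat) = Linked-∷ (All-runStartsFrom x xs x<xs) (flatFrom⇒linked x xs flat)

-- Every entry is at least the first entry of its run.
below-runStarts : ∀ q p xs → q ≤ p → Linked _<_ (q ∷ runStartsFrom p xs) → All (q <_) xs
below-runStarts q p []       _   _ = []
below-runStarts q p (y ∷ ys) q≤p q↗ with p <? y
... | yes p<y = ≤-<-trans q≤p p<y ∷ below-runStarts q y ys (<⇒≤ (≤-<-trans q≤p p<y)) q↗
... | no  _ with q<y ∷ y↗ ← q↗ =
  q<y ∷ All.map (<-trans q<y) (below-runStarts y y ys ≤-refl y↗)

linked⇒flatFrom : ∀ p xs → Linked _<_ (runStartsFrom p xs) → FlatFrom p xs
linked⇒flatFrom p []       _  = tt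
linked⇒flatFrom p (y ∷ ys) rs↗ with p <? y
... | yes p<y = inj₁ p<y , linked⇒flatFrom y ys rs↗
... | no  _   = inj₂ (below-runStarts y y ys ≤-refl rs↗) , linked⇒flatFrom y ys (Linked.tail rs↗)

flattened⇒flat : ∀ w → Flattened w → Flat w
flattened⇒flat []       _   = tt
flattened⇒flat (x ∷ xs) rs↗ = below-runStarts x x xs ≤-refl rs↗ , linked⇒flatFrom x xs (Linked.tail rs↗)

flatFrom-deleteMax : ∀ {n} p as bs → All (_< n) (as ++ bs) → FlatFrom p (as ++ n ∷ bs) → FlatFrom p (as ++ bs)
flatFrom-deleteMax p []       []       _           _                          = tt
flatFrom-deleteMax p []       (y ∷ bs) (y<n ∷ _)   (_ , inj₁ n<y , _)        = contradiction y<n (<-asym n<y)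
flatFrom-deleteMax p []       (y ∷ bs) _           (_ , inj₂ y<bs , flat)    = inj₂ y<bs , flat
flatFrom-deleteMax p (y ∷ as) bs       (_ ∷ w<n)  (p<y⊎y<w , flat)          =
  map₂ (All-insertion⁻ (∈-insertions⁺ as bs)) p<y⊎y<w , flatFrom-deleteMax y as bs w<n flat

flat-deleteMax : ∀ {n} as bs → All (_< n) (as ++ bs) → Flat (as ++ n ∷ bs) → Flat (as ++ bs)
flat-deleteMax []       []       _            _                  = tt
flat-deleteMax []       (y ∷ bs) (y<n ∷ _)    ((n<y ∷ _) , _)   = contradiction y<n (<-asym n<y)
flat-deleteMax (x ∷ as) bs       (_ ∷ w<n)   (x<w , flat)      = All-insertion⁻ (∈-insertions⁺ as bs) x<w , flatFrom-deleteMax x as bs w<n flat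

map-rlm-∷-min : ∀ {y zs} → All (All (y <_)) zs → map rlm (map (y ∷_) zs) ≡ map suc (map rlm zs)
map-rlm-∷-min []            = refl
map-rlm-∷-min (y<z ∷ y<zs) = cong₂ _∷_ (rlm-∷-min y<z) (map-rlm-∷-min y<zs)

map-rlm-∷-nonmin : ∀ {y zs} → All (λ z → ¬ All (y <_) z) zs → map rlm (map (y ∷_) zs) ≡ map rlm zs
map-rlm-∷-nonmin []              = refl
map-rlm-∷-nonmin (y≮z ∷ y≮zs) = cong₂ _∷_ (rlm-∷-nonmin y≮z) (map-rlm-∷-nonmin y≮zs)

flatInsertions : ℕ → List ℕ → List (List ℕ)
flatInsertions n w = filter flat? (insertions n w)

-- The right-to-left minima counts of the flattened insertions of a new maximum
-- into a flattened word with r right-to-left minima.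
insertedRlms : ℕ → List ℕ
insertedRlms r = replicate (pred r) r ++ [ suc r ]

copiesThenSuc : ℕ → List ℕ
copiesThenSuc r = replicate r r ++ [ suc r ]

map-suc-copiesThenSuc : ∀ r → map suc (copiesThenSuc r) ≡ insertedRlms (suc r)
map-suc-copiesThenSuc r = trans (map-++ suc (replicate r r) _) (cong (_++ [ suc (suc r) ]) (map-replicate suc r r))

filter-flatFrom-∷ : ∀ {p y n ys} → p < y ⊎ All (y <_) ys → y < n →
                    filter (flatFrom? p) (map (y ∷_) (insertions n ys)) ≡ map (y ∷_) (filter (flatFrom? y) (insertions n ys))
filter-flatFrom-∷ p<y⊎y<ys y<n = filter-map (flatFrom? _) (flatFrom? _) (_ ∷_) (All.tabulate λ z∈ →
  mk⇔ proj₂ (map₂ (λ y<ys → All-insertion⁺ z∈ y<n y<ys) p<y⊎y<ys ,_))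

-- Inserting n just before y keeps the word flattened iff y is a right-to-left minimum,
-- and inserting it at the end always does; only the latter adds a right-to-left minimum.
rlm-flatFromInsertions : ∀ {n p} ys → p < n → All (_< n) ys → FlatFrom p ys →
  map rlm (filter (flatFrom? p) (insertions n ys)) ≡ copiesThenSuc (rlm ys)
rlm-flatFromInsertions {n} {p} []       p<n []            _ = cong (map rlm) (filter-accept (flatFrom? p) (inj₁ p<n , tt))
rlm-flatFromInsertions {n} {p} (y ∷ ys) p<n (y<n ∷ ys<n) (p<y⊎y<ys , flat) = byMinimality (all? (y <?_) ys)
  where
  open ≡-Reasoning
  rest = filter (flatFrom? y) (insertions n ys)

  byMinimality : Dec (All (y <_) ys) →
    map rlm (filter (flatFrom? p) (insertions n (y ∷ ys))) ≡ copiesThenSuc (rlm (y ∷ ys))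
  byMinimality (yes y<ys) = begin
    map rlm (filter (flatFrom? p) ((n ∷ y ∷ ys) ∷ map (y ∷_) (insertions n ys)))
      ≡⟨ cong (map rlm) (filter-accept (flatFrom? p) (inj₁ p<n , inj₂ y<ys , flat)) ⟩
    rlm (n ∷ y ∷ ys) ∷ map rlm (filter (flatFrom? p) (map (y ∷_) (insertions n ys)))
      ≡⟨ cong₂ _∷_ (trans (rlm-∷-nonmin n≮y∷ys) (rlm-∷-min y<ys)) (cong (map rlm) (filter-flatFrom-∷ p<y⊎y<ys y<n)) ⟩
    suc (rlm ys) ∷ map rlm (map (y ∷_) rest)
      ≡⟨ cong (suc (rlm ys) ∷_) (map-rlm-∷-min (AllP.filter⁺ (flatFrom? y) (All.tabulate λ z∈ → All-insertion⁺ z∈ y<n y<ys))) ⟩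
    suc (rlm ys) ∷ map suc (map rlm rest)
      ≡⟨ cong (λ rs → suc (rlm ys) ∷ map suc rs) (rlm-flatFromInsertions ys y<n ys<n flat) ⟩
    suc (rlm ys) ∷ map suc (copiesThenSuc (rlm ys))
      ≡⟨ cong (suc (rlm ys) ∷_) (map-suc-copiesThenSuc (rlm ys)) ⟩
    copiesThenSuc (suc (rlm ys))
      ≡⟨ cong copiesThenSuc (sym (rlm-∷-min y<ys)) ⟩
    copiesThenSuc (rlm (y ∷ ys)) ∎
    where
    n≮y∷ys : ¬ All (n <_) (y ∷ ys)
    n≮y∷ys (n<y ∷ _) = <-asym n<y y<n
  byMinimality (no ¬y<ys) = begin
    map rlm (filter (flatFrom? p) ((n ∷ y ∷ ys) ∷ map (y ∷_) (insertions n ys)))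
      ≡⟨ cong (map rlm) (filter-reject (flatFrom? p) front-rejected) ⟩
    map rlm (filter (flatFrom? p) (map (y ∷_) (insertions n ys)))
      ≡⟨ cong (map rlm) (filter-flatFrom-∷ p<y⊎y<ys y<n) ⟩
    map rlm (map (y ∷_) rest)
      ≡⟨ map-rlm-∷-nonmin (AllP.filter⁺ (flatFrom? y) (All.tabulate λ z∈ → ¬y<ys ∘ All-insertion⁻ z∈)) ⟩
    map rlm rest
      ≡⟨ rlm-flatFromInsertions ys y<n ys<n flat ⟩
    copiesThenSuc (rlm ys)
      ≡⟨ cong copiesThenSuc (sym (rlm-∷-nonmin ¬y<ys)) ⟩
    copiesThenSuc (rlm (y ∷ ys)) ∎
    where
    front-rejected : ¬ FlatFrom p (n ∷ y ∷ ys)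
    front-rejected (_ , inj₁ n<y , _)  = <-asym n<y y<n
    front-rejected (_ , inj₂ y<ys , _) = ¬y<ys y<ys

rlm-flatInsertions : ∀ {n} w → All (_< n) w → Flat w → map rlm (flatInsertions n w) ≡ insertedRlms (rlm w)
rlm-flatInsertions []       _             _              = refl
rlm-flatInsertions {n} (x ∷ xs) (x<n ∷ xs<n) (x<xs , flat) = begin
  map rlm (filter flat? ((n ∷ x ∷ xs) ∷ map (x ∷_) (insertions n xs)))
    ≡⟨ cong (map rlm) (filter-reject flat? front-rejected) ⟩
  map rlm (filter flat? (map (x ∷_) (insertions n xs)))
    ≡⟨ cong (map rlm) (filter-map flat? (flatFrom? x) (x ∷_) (All.tabulate λ z∈ → mk⇔ proj₂ (All-insertion⁺ z∈ x<n x<xs ,_))) ⟩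
  map rlm (map (x ∷_) rest)
    ≡⟨ map-rlm-∷-min (AllP.filter⁺ (flatFrom? x) (All.tabulate λ z∈ → All-insertion⁺ z∈ x<n x<xs)) ⟩
  map suc (map rlm rest)
    ≡⟨ cong (map suc) (rlm-flatFromInsertions xs x<n xs<n flat) ⟩
  map suc (copiesThenSuc (rlm xs))
    ≡⟨ map-suc-copiesThenSuc (rlm xs) ⟩
  insertedRlms (suc (rlm xs))
    ≡⟨ cong insertedRlms (sym (rlm-∷-min x<xs)) ⟩
  insertedRlms (rlm (x ∷ xs)) ∎
  where
  open ≡-Reasoning
  rest = filter (flatFrom? x) (insertions n xs)
  front-rejected : ¬ Flat (n ∷ x ∷ xs)
  front-rejected ((n<x ∷ _) , _) = <-asym n<x x<n

-- Flattened permutations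

record IsPermutation (n : ℕ) (w : List ℕ) : Set where
  constructor isPermutation
  field
    length≡  : length w ≡ n
    bounded  : All (_< n) w
    distinct : Unique w
open IsPermutation

All-<-pred : ∀ {n xs} → All (_< suc n) xs → All (n ≢_) xs → All (_< n) xs
All-<-pred = curry (All.zipWith λ (x<1+n , n≢x) → ≤∧≢⇒< (m<1+n⇒m≤n x<1+n) (≢-sym n≢x))

isPermutation-insertMax : ∀ {n v w} → w ↭ n ∷ v → IsPermutation n v → IsPermutation (suc n) w
isPermutation-insertMax w↭n∷v (isPermutation len v<n v-uniq) = isPermutation
  (trans (↭-length w↭n∷v) (cong suc len))
  (All-resp-↭ (↭-sym w↭n∷v) (n<1+n _ ∷ All.map m<n⇒m<1+n v<n))
  (Unique-resp-↭ (↭-sym w↭n∷v) (All.map >⇒≢ v<n ∷ v-uniq))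

isPermutation-deleteMax : ∀ {n v w} → w ↭ n ∷ v → IsPermutation (suc n) w → IsPermutation n v
isPermutation-deleteMax w↭n∷v (isPermutation len w<1+n w-uniq)
  with _ ∷ v<1+n ← All-resp-↭ w↭n∷v w<1+n
  with n∉v ∷ v-uniq ← Unique-resp-↭ w↭n∷v w-uniq =
  isPermutation (suc-injective (trans (sym (↭-length w↭n∷v)) len)) (All-<-pred v<1+n n∉v) v-uniq

max-∈-permutation : ∀ {n w} → IsPermutation (suc n) w → n ∈ w
max-∈-permutation {n} {w} (isPermutation len w<1+n w-uniq) with n ∈? w
... | yes n∈w = n∈w
... | no  n∉w = contradiction (length-unique-bounded w-uniq w<n) (subst (_≰ n) (sym len) 1+n≰n)
  where
  w<n : All (_< n) w
  w<n = All-<-pred w<1+n (All.tabulate λ x∈w n≡x → n∉w (subst (_∈ w) (sym n≡x) x∈w))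

flatPerms : ℕ → List (List ℕ)
flatPerms zero    = [] ∷ []
flatPerms (suc n) = concatMap (flatInsertions n) (flatPerms n)

flatPerms-sound : ∀ {n w} → w ∈ flatPerms n → IsPermutation n w × Flat w
flatPerms-sound {zero}  (here refl) = isPermutation refl [] [] , tt
flatPerms-sound {suc n} w∈
  with v , v∈ , w∈flatIns ← find (∈-concatMap⁻ (flatInsertions n) {xs = flatPerms n} w∈)
  with w∈ins , flat ← ∈-filter⁻ flat? {xs = insertions n v} w∈flatIns =
  isPermutation-insertMax (insertion-↭ w∈ins) (proj₁ (flatPerms-sound v∈)) , flat

flatPerms-complete : ∀ {n w} → IsPermutation n w → Flat w → w ∈ flatPerms n
flatPerms-complete {zero}  {[]} _ _ = here refl
flatPerms-complete {suc n} {w} perm flat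
  with as , bs , refl ← ∈-∃++ (max-∈-permutation perm) =
  ∈-concatMap⁺ (flatInsertions n) (lose v∈ (∈-filter⁺ flat? (∈-insertions⁺ as bs) flat))
  where
  v-perm = isPermutation-deleteMax (shift n as bs) perm
  v∈ = flatPerms-complete v-perm (flat-deleteMax as bs (bounded v-perm) flat)

flatPerms-unique : ∀ n → Unique (flatPerms n)
flatPerms-unique zero    = [] ∷ []
flatPerms-unique (suc n) = unique-concatMap (flatInsertions n) (filter (_<? n)) (flatPerms-unique n)
  (λ v∈ → UniqueP.filter⁺ flat? (insertions-unique (n∉ (bounded (proj₁ (flatPerms-sound v∈))))))
  (λ v∈ w∈ → filter-<-insertion (bounded (proj₁ (flatPerms-sound v∈))) (proj₁ (∈-filter⁻ flat? w∈)))
  where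
  n∉ : ∀ {v} → All (_< n) v → n ∉ v
  n∉ v<n n∈v = <-irrefl refl (All.lookup v<n n∈v)

rlm-flatPerms-suc : ∀ n → map rlm (flatPerms (suc n)) ≡ concatMap insertedRlms (map rlm (flatPerms n))
rlm-flatPerms-suc n = begin
  map rlm (concatMap (flatInsertions n) (flatPerms n))  ≡⟨ map-concatMap rlm (flatInsertions n) (flatPerms n) ⟩
  concatMap (map rlm ∘ flatInsertions n) (flatPerms n)  ≡⟨ cong concat (map-cong-local (All.tabulate rlm-flatInsertions-∈)) ⟩
  concatMap (insertedRlms ∘ rlm) (flatPerms n)          ≡⟨ concatMap-map insertedRlms rlm (flatPerms n) ⟨
  concatMap insertedRlms (map rlm (flatPerms n))        ∎
  where
  open ≡-Reasoning
  rlm-flatInsertions-∈ : ∀ {v} → v ∈ flatPerms n → map rlm (flatInsertions n v) ≡ insertedRlms (rlm v)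
  rlm-flatInsertions-∈ v∈ with perm , flat ← flatPerms-sound v∈ = rlm-flatInsertions _ (bounded perm) flat

-- Counting right-to-left minima

count : ℕ → List ℕ → ℕ
count k xs = length (filter (_≟ k) xs)

count-++ : ∀ k xs ys → count k (xs ++ ys) ≡ count k xs + count k ys
count-++ k xs ys = trans (cong length (filter-++ (_≟ k) xs ys)) (length-++ (filter (_≟ k) xs))

count-replicate-≡ : ∀ k m → count k (replicate m k) ≡ m
count-replicate-≡ k m = trans (cong length (filter-all (_≟ k) (AllP.replicate⁺ m refl))) (length-replicate m)

count-replicate-≢ : ∀ {x k} m → x ≢ k → count k (replicate m x) ≡ 0
count-replicate-≢ {k = k} m x≢k = cong length (filter-none (_≟ k) (AllP.replicate⁺ m x≢k))

count-[-]-≡ : ∀ k → count k [ k ] ≡ 1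
count-[-]-≡ k = cong length (filter-accept (_≟ k) refl)

count-[-]-≢ : ∀ {x k} → x ≢ k → count k [ x ] ≡ 0
count-[-]-≢ = count-replicate-≢ 1

count-insertedRlms-zero : ∀ r → count 0 (insertedRlms r) ≡ 0
count-insertedRlms-zero zero    = refl
count-insertedRlms-zero (suc r) =
  cong length (filter-none (_≟ 0) (AllP.++⁺ (AllP.replicate⁺ r λ ()) ((λ ()) ∷ [])))

count-insertedRlms-suc : ∀ j r → count (suc j) (insertedRlms r) ≡ j * count (suc j) [ r ] + count j [ r ]
count-insertedRlms-suc j r with r ≟ suc j | r ≟ j
... | yes refl | _ = begin
  count (suc j) (replicate j (suc j) ++ [ suc (suc j) ])  ≡⟨ count-++ (suc j) (replicate j (suc j)) _ ⟩
  count (suc j) (replicate j (suc j)) + count (suc j) [ suc (suc j) ]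
    ≡⟨ cong₂ _+_ (count-replicate-≡ (suc j) j) (count-[-]-≢ {k = suc j} 1+n≢n) ⟩
  j + 0                                                   ≡⟨ cong₂ _+_ (*-identityʳ j) (count-[-]-≢ {k = j} 1+n≢n) ⟨
  j * 1 + count j [ suc j ]                               ≡⟨ cong (λ c → j * c + count j [ suc j ]) (count-[-]-≡ (suc j)) ⟨
  j * count (suc j) [ suc j ] + count j [ suc j ]         ∎
  where open ≡-Reasoning
... | no r≢1+j | yes refl = begin
  count (suc j) (replicate (pred j) j ++ [ suc j ])       ≡⟨ count-++ (suc j) (replicate (pred j) j) _ ⟩
  count (suc j) (replicate (pred j) j) + count (suc j) [ suc j ]
    ≡⟨ cong₂ _+_ (count-replicate-≢ (pred j) r≢1+j) (count-[-]-≡ (suc j)) ⟩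
  1                                                       ≡⟨ cong₂ _+_ (*-zeroʳ j) (count-[-]-≡ j) ⟨
  j * 0 + count j [ j ]                                   ≡⟨ cong (λ c → j * c + count j [ j ]) (count-[-]-≢ r≢1+j) ⟨
  j * count (suc j) [ j ] + count j [ j ]                 ∎
  where open ≡-Reasoning
... | no r≢1+j | no r≢j = begin
  count (suc j) (replicate (pred r) r ++ [ suc r ])       ≡⟨ count-++ (suc j) (replicate (pred r) r) _ ⟩
  count (suc j) (replicate (pred r) r) + count (suc j) [ suc r ]
    ≡⟨ cong₂ _+_ (count-replicate-≢ (pred r) r≢1+j) (count-[-]-≢ (r≢j ∘ suc-injective)) ⟩
  0                                                       ≡⟨ cong₂ _+_ (*-zeroʳ j) (count-[-]-≢ r≢j) ⟨
  j * 0 + count j [ r ]                                   ≡⟨ cong (λ c → j * c + count j [ r ]) (count-[-]-≢ r≢1+j) ⟨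
  j * count (suc j) [ r ] + count j [ r ]                 ∎
  where open ≡-Reasoning

count-concatMap-insertedRlms-zero : ∀ rs → count 0 (concatMap insertedRlms rs) ≡ 0
count-concatMap-insertedRlms-zero []       = refl
count-concatMap-insertedRlms-zero (r ∷ rs) = trans (count-++ 0 (insertedRlms r) _)
  (cong₂ _+_ (count-insertedRlms-zero r) (count-concatMap-insertedRlms-zero rs))

count-concatMap-insertedRlms-suc : ∀ j rs →
  count (suc j) (concatMap insertedRlms rs) ≡ j * count (suc j) rs + count j rs
count-concatMap-insertedRlms-suc j []       = sym (cong (_+ 0) (*-zeroʳ j))
count-concatMap-insertedRlms-suc j (r ∷ rs) = begin
  count (suc j) (insertedRlms r ++ concatMap insertedRlms rs)
    ≡⟨ count-++ (suc j) (insertedRlms r) _ ⟩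
  count (suc j) (insertedRlms r) + count (suc j) (concatMap insertedRlms rs)
    ≡⟨ cong₂ _+_ (count-insertedRlms-suc j r) (count-concatMap-insertedRlms-suc j rs) ⟩
  (j * count (suc j) [ r ] + count j [ r ]) + (j * count (suc j) rs + count j rs)
    ≡⟨ interchange j (count (suc j) [ r ]) (count j [ r ]) (count (suc j) rs) (count j rs) ⟩
  j * (count (suc j) [ r ] + count (suc j) rs) + (count j [ r ] + count j rs)
    ≡⟨ cong₂ (λ a b → j * a + b) (count-++ (suc j) [ r ] rs) (count-++ j [ r ] rs) ⟨
  j * count (suc j) (r ∷ rs) + count j (r ∷ rs) ∎
  where
  open ≡-Reasoning
  interchange : ∀ j a b c d → (j * a + b) + (j * c + d) ≡ j * (a + c) + (b + d)
  interchange = solve-∀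

count-rlm-flatPerms : ∀ m k → count (suc k) (map rlm (flatPerms (suc m))) ≡ S2 m k
count-rlm-flatPerms zero    zero    = refl
count-rlm-flatPerms zero    (suc k) = refl
count-rlm-flatPerms (suc m) k       = begin
  count (suc k) (map rlm (flatPerms (suc (suc m))))  ≡⟨ cong (count (suc k)) (rlm-flatPerms-suc (suc m)) ⟩
  count (suc k) (concatMap insertedRlms rlms)        ≡⟨ count-concatMap-insertedRlms-suc k rlms ⟩
  k * count (suc k) rlms + count k rlms              ≡⟨ stirlingStep k ⟩
  S2 (suc m) k                                       ∎
  where
  open ≡-Reasoning
  rlms = map rlm (flatPerms (suc m))
  stirlingStep : ∀ k → k * count (suc k) rlms + count k rlms ≡ S2 (suc m) k
  stirlingStep zero    = trans (cong (count 0) (rlm-flatPerms-suc m)) (count-concatMap-insertedRlms-zero (map rlm (flatPerms m)))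
  stirlingStep (suc k) = cong₂ (λ a b → suc k * a + b) (count-rlm-flatPerms m (suc k)) (count-rlm-flatPerms m k)

-- One-line notation

words-complete : ∀ {m n} (v : Vec (Fin n) m) → v ∈ words m n
words-complete []                = here refl
words-complete {suc m} {n} (x ∷ v) =
  ∈-concatMap⁺ (λ y → map (y ∷_) (words m n)) (lose (∈-allFin x) (∈-map⁺ (x ∷_) (words-complete v)))

words-unique : ∀ m n → Unique (words m n)
words-unique zero    n = [] ∷ []
words-unique (suc m) n = unique-concatMap (λ y → map (y ∷_) (words m n)) Vec.head (UniqueP.allFin⁺ n)
  (λ _ → UniqueP.map⁺ VecP.∷-injectiveʳ (words-unique m n))
  (λ _ w∈ → head-∈-map-∷ w∈)
  where
  head-∈-map-∷ : ∀ {y w} → w ∈ map (y ∷_) (words m n) → Vec.head w ≡ y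
  head-∈-map-∷ w∈ with _ , _ , refl ← ∈-map⁻ _ w∈ = refl

toℕs-injective : ∀ {m n} {v w : Vec (Fin n) m} → map toℕ (toList v) ≡ map toℕ (toList w) → v ≡ w
toℕs-injective {v = []}    {[]}    _  = refl
toℕs-injective {v = x ∷ v} {y ∷ w} eq = cong₂ _∷_ (toℕ-injective (∷-injectiveˡ eq)) (toℕs-injective (∷-injectiveʳ eq))

toℕs-surjective : ∀ {m n w} → length w ≡ m → All (_< n) w → ∃ λ (v : Vec (Fin n) m) → map toℕ (toList v) ≡ w
toℕs-surjective {zero}  {w = []}    _   []            = [] , refl
toℕs-surjective {suc m} {w = x ∷ w} len (x<n ∷ w<n) with v , v≡w ← toℕs-surjective (suc-injective len) w<n =
  fromℕ< x<n ∷ v , cong₂ _∷_ (toℕ-fromℕ< x<n) v≡w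

oneLine-isPermutation : ∀ {n} (v : Vec (Fin n) n) → IsPerm v → IsPermutation n (oneLine v)
oneLine-isPermutation v v-perm = isPermutation
  (trans (length-map toℕ (toList v)) (VecP.length-toList v))
  (AllP.map⁺ (All.universal toℕ<n (toList v)))
  (UniqueP.map⁺ toℕ-injective v-perm)

countedPerm? : ∀ n k (v : Vec (Fin n) n) → Dec (IsPerm v × Flattened (oneLine v) × rlm (oneLine v) ≡ k)
countedPerm? n k v = isPerm? v ×-dec (flattened? (oneLine v) ×-dec (rlm (oneLine v) ≟ k))

oneLine-countedPerms∼flatPerms : ∀ n k →
  map oneLine (filter (countedPerm? n k) (words n n)) ∼[ set ] filter ((_≟ k) ∘ rlm) (flatPerms n)
oneLine-countedPerms∼flatPerms n k = mk⇔ to from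
  where
  to : ∀ {w} → w ∈ map oneLine (filter (countedPerm? n k) (words n n)) → w ∈ filter ((_≟ k) ∘ rlm) (flatPerms n)
  to w∈ with v , v∈ , refl ← ∈-map⁻ oneLine w∈
        with _ , v-perm , flattened , rlm≡k ← ∈-filter⁻ (countedPerm? n k) {xs = words n n} v∈ =
    ∈-filter⁺ ((_≟ k) ∘ rlm) (flatPerms-complete (oneLine-isPermutation v v-perm) (flattened⇒flat _ flattened)) rlm≡k
  isPermutation-∈ : ∀ {w} → w ∈ filter ((_≟ k) ∘ rlm) (flatPerms n) → IsPermutation n w
  isPermutation-∈ w∈ = proj₁ (flatPerms-sound (proj₁ (∈-filter⁻ ((_≟ k) ∘ rlm) {xs = flatPerms n} w∈)))
  fromOneLine : ∀ {w} → ∃[ v ] oneLine v ≡ w → w ∈ filter ((_≟ k) ∘ rlm) (flatPerms n) →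
                w ∈ map oneLine (filter (countedPerm? n k) (words n n))
  fromOneLine (v , refl) w∈
    with w∈flatPerms , rlm≡k ← ∈-filter⁻ ((_≟ k) ∘ rlm) {xs = flatPerms n} w∈
    with perm , flat ← flatPerms-sound {n} w∈flatPerms =
    ∈-map⁺ oneLine (∈-filter⁺ (countedPerm? n k) (words-complete v)
      (UniqueP.map⁻ (distinct perm) , flat⇒flattened _ flat , rlm≡k))
  from : ∀ {w} → w ∈ filter ((_≟ k) ∘ rlm) (flatPerms n) → w ∈ map oneLine (filter (countedPerm? n k) (words n n))
  from w∈ = fromOneLine (toℕs-surjective (length≡ (isPermutation-∈ w∈)) (bounded (isPermutation-∈ w∈))) w∈

frlm≡count : ∀ n k → frlm n k ≡ count k (map rlm (flatPerms n))
frlm≡count n k = begin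
  length (filter (countedPerm? n k) (words n n))                ≡⟨ length-map oneLine (filter (countedPerm? n k) (words n n)) ⟨
  length (map oneLine (filter (countedPerm? n k) (words n n)))  ≡⟨ length-unique-set oneLines-unique flats-unique (oneLine-countedPerms∼flatPerms n k) ⟩
  length (filter ((_≟ k) ∘ rlm) (flatPerms n))                  ≡⟨ length-map rlm (filter ((_≟ k) ∘ rlm) (flatPerms n)) ⟨
  length (map rlm (filter ((_≟ k) ∘ rlm) (flatPerms n)))        ≡⟨ cong length (filter-map (_≟ k) ((_≟ k) ∘ rlm) rlm (All.universal (λ _ → mk⇔ id id) (flatPerms n))) ⟨
  count k (map rlm (flatPerms n))                               ∎
  where
  open ≡-Reasoning
  oneLines-unique = UniqueP.map⁺ toℕs-injective (UniqueP.filter⁺ (countedPerm? n k) (words-unique n n))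
  flats-unique    = UniqueP.filter⁺ ((_≟ k) ∘ rlm) (flatPerms-unique n)

corollary3p10 : (n k : ℕ) → n ≥ 1 → k ≥ 1 → frlm n k ≡ S2 (n ∸ 1) (k ∸ 1)
corollary3p10 (suc m) (suc k) _ _ = trans (frlm≡count (suc m) (suc k)) (count-rlm-flatPerms m k)
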